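{- $s(n,\Delta(r,r))=\Theta(r^2)$, where $\Delta(r,r)=\{K_{1,r},rK_2\}$.
   Context: For a graph $H$, $F_{H,0}$ is the set of maps $f:E(H)\to E(H)$ with $f(e)\cap e=\emptyset$ for every $e$. A subgraph $G'$ of $H$ is $f$-exclusive if $f(e)\cap V(G')=\emptyset$ for every $e\in E(G')$. For a family $\mathcal{G}$ of graphs, $s(n,\mathcal{G})$ is the maximum number of edges of an $n$-vertex graph $H$ for which some $f\in F_{H,0}$ exists such that $H$ contains no $f$-exclusive copy of any member of $\mathcal{G}$. $rK_2$ is a matching with $r$ edges. -}

module Defs where

open import Data.Nat using (ℕ; _+_; _*_; _≤_)
open import Data.Fin using (Fin; zero; suc; _↑ˡ_; _↑ʳ_) renaming (_<_ to _<ᶠ_)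
open import Data.List using (List; length; lookup; map; allFin)
open import Data.List.Relation.Unary.All using (All)
open import Data.List.Relation.Unary.Any using (Any)
open import Data.List.Relation.Unary.Unique.Propositional using (Unique)
open import Data.Product using (Σ; _×_; _,_; proj₁; proj₂)
open import Data.Sum using (_⊎_)
open import Relation.Binary.PropositionalEquality using (_≡_; _≢_)
open import Relation.Nullary using (¬_)
open import Function.Definitions using (Injective)

-- A finite simple graph on vertex set Fin n, given by its list of edges;
-- each edge {u,v} is stored once, as the pair (u , v) with u < v.
record Graph (n : ℕ) : Set where
  field
    E        : List (Fin n × Fin n)
    E-sorted : All (λ p → proj₁ p <ᶠ proj₂ p) E
    E-unique : Unique E
open Graph public

edgeCount : ∀ {n} → Graph n → ℕ
edgeCount H = length (E H)

Edge : ∀ {n} → Graph n → Set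
Edge H = Fin (edgeCount H)

ends : ∀ {n} (H : Graph n) → Edge H → Fin n × Fin n
ends H i = lookup (E H) i

NotOn : ∀ {n} → Fin n → Fin n × Fin n → Set
NotOn v (a , b) = (v ≢ a) × (v ≢ b)

DisjointEdges : ∀ {n} → Fin n × Fin n → Fin n × Fin n → Set
DisjointEdges e (c , d) = NotOn c e × NotOn d e

F₀ : ∀ {n} → Graph n → Set
F₀ H = Σ (Edge H → Edge H) λ f → ∀ e → DisjointEdges (ends H (f e)) (ends H e)

Pattern : ℕ → Set
Pattern k = List (Fin k × Fin k)

-- V(G') = image of φ, E(G') = image of ψ.
record Copy {n k : ℕ} (H : Graph n) (P : Pattern k) : Set where
  field
    φ     : Fin k → Fin n
    φ-inj : Injective _≡_ _≡_ φ
    ψ     : Fin (length P) → Edge H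
    ψ-ok  : ∀ j → (ends H (ψ j) ≡ (φ (proj₁ (lookup P j)) , φ (proj₂ (lookup P j))))
                ⊎ (ends H (ψ j) ≡ (φ (proj₂ (lookup P j)) , φ (proj₁ (lookup P j))))
open Copy public

Exclusive : ∀ {n k} (H : Graph n) (f : F₀ H) {P : Pattern k} → Copy H P → Set
Exclusive {k = k} H f C =
  ∀ j (v : Fin k) → NotOn (φ C v) (ends H (proj₁ f (ψ C j)))

HasExclusiveCopy : ∀ {n k} (H : Graph n) (f : F₀ H) → Pattern k → Set
HasExclusiveCopy H f P = Σ (Copy H P) (Exclusive H f)

Family : Set
Family = List (Σ ℕ Pattern)

Admissible : ∀ {n} → Family → Graph n → Set
Admissible 𝒢 H =
  Σ (F₀ H) λ f → ¬ Any (λ G → HasExclusiveCopy H f (proj₂ G)) 𝒢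

IsS : ℕ → Family → ℕ → Set
IsS n 𝒢 s =
  (Σ (Graph n) λ H → Admissible 𝒢 H × edgeCount H ≡ s)
  × (∀ (H : Graph n) → Admissible 𝒢 H → edgeCount H ≤ s)

Star : (r : ℕ) → Pattern (Data.Nat.suc r)
Star r = map (λ i → (zero , suc i)) (allFin r)

Matching : (r : ℕ) → Pattern (r + r)
Matching r = map (λ i → (i ↑ˡ r , r ↑ʳ i)) (allFin r)

Δ : ℕ → Family
Δ r = (Data.Nat.suc r , Star r) Data.List.∷ (r + r , Matching r) Data.List.∷ Data.List.[]

{-# OPTIONS --safe #-}
module Submission where

-- Upper bound: in a digraph with out-degrees ≤ a, any r(2a + 1) vertices contain r pairwise
-- non-adjacent ones.  Among the edges at a vertex w, "e′ = e or e′ meets f(e)" has out-degree ≤ 3,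
-- so a vertex of degree ≥ 7r carries an f-exclusive K_{1,r}.  Otherwise all degrees are < 7r,
-- "e′ meets e or f(e)" has out-degree ≤ 4·7r, and r(1 + 8·7r) ≤ 57r² edges already give an
-- f-exclusive rK₂.  Lower bound: for a = ⌊r/2⌋ ≥ 2, K_{a,a} has no copy of K_{1,r} or rK₂ at all,
-- and (i, j) ↦ (i′, j′) with i′ ≠ i, j′ ≠ j lies in F_{H,0}; so s ≥ a² ≥ r²/9.  The maximum s
-- exists because admissibility is decidable by finite search.

open import Defs
open import Data.Nat using (ℕ; zero; suc; _+_; _*_; _≤_; _<_; z≤n; s≤s; z<s; _≤?_; ⌊_/2⌋)
open import Data.Nat.Properties
open import Algebra.Properties.CommutativeSemigroup +-commutativeSemigroup using (interchange)
open import Data.Fin as Fin using (Fin; zero; suc; toℕ; fromℕ<; splitAt; _↑ˡ_; _↑ʳ_) renaming (_<_ to _<ᶠ_)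
open import Data.Fin.Properties as Finₚ using (splitAt-↑ˡ; splitAt-↑ʳ)
open import Data.List as List using (List; []; _∷_; length; lookup; filter; allFin)
open import Data.List.Properties using (length-tabulate; tabulate-cong; tabulate-lookup)
open import Data.List.Membership.Propositional using (_∈_)
open import Data.List.Membership.Propositional.Properties
  using (∈-filter⁻; ∈-lookup; ∈-map⁺; ∈-map⁻; ∈-allFin; ∈-tabulate⁺; ∈-tabulate⁻)
open import Data.List.Relation.Unary.All as All using (All; []; _∷_)
import Data.List.Relation.Unary.All.Properties as Allₚ
open import Data.List.Relation.Unary.Any as Any using (Any; here; there)
import Data.List.Relation.Unary.Any.Properties as Anyₚ
open import Data.List.Relation.Unary.AllPairs using ([]; _∷_)
open import Data.List.Relation.Unary.Unique.Propositional using (Unique)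
import Data.List.Relation.Unary.Unique.Propositional.Properties as Uniqueₚ
import Data.List.Relation.Unary.Unique.DecPropositional as UniqueDec
open import Data.Product.Properties using (≡-dec)
open import Data.Vec.Functional as Vector using (Vector)
open import Data.Product using (Σ; ∃; _×_; _,_; proj₁; proj₂; swap; map; uncurry)
open import Data.Sum using (_⊎_; inj₁; inj₂; reduce)
open import Function using (id; _∘_; case_of_)
open import Data.Nat.Tactic.RingSolver using (solve-∀)
open import Relation.Nullary using (¬_; Dec; yes; no; contradiction)
open import Relation.Nullary.Decidable using (_⊎-dec_; _×-dec_; _→-dec_; ¬?; map′)
open import Function.Definitions using (Injective)
open import Relation.Unary using (Decidable)
open import Relation.Unary.Properties using (∁?; _∪?_)
open import Relation.Binary.PropositionalEquality
  using (_≡_; _≢_; _≗_; refl; sym; trans; cong; cong₂; subst; subst₂; module ≡-Reasoning)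

𝟙 : {P : Set} → Dec P → ℕ
𝟙 (yes _) = 1
𝟙 (no _)  = 0

module _ {A : Set} where

  ∑ : List A → (A → ℕ) → ℕ
  ∑ []       f = 0
  ∑ (x ∷ xs) f = f x + ∑ xs f

  syntax ∑ xs (λ x → e) = ∑[ x ∈ xs ] e

  ∑-+ : ∀ xs (f g : A → ℕ) → ∑[ x ∈ xs ] (f x + g x) ≡ ∑ xs f + ∑ xs g
  ∑-+ []       f g = refl
  ∑-+ (x ∷ xs) f g = trans (cong (f x + g x +_) (∑-+ xs f g)) (interchange (f x) (g x) (∑ xs f) (∑ xs g))

  ∑-zero : ∀ xs → ∑[ x ∈ xs ] 0 ≡ 0
  ∑-zero []       = refl
  ∑-zero (x ∷ xs) = ∑-zero xs

  ∑-comm : ∀ xs ys (F : A → A → ℕ) → ∑[ x ∈ xs ] ∑[ y ∈ ys ] F x y ≡ ∑[ y ∈ ys ] ∑[ x ∈ xs ] F x y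
  ∑-comm []       ys F = sym (∑-zero ys)
  ∑-comm (x ∷ xs) ys F = trans (cong (∑ ys (F x) +_) (∑-comm xs ys F)) (sym (∑-+ ys (F x) _))

  ∑-mono : ∀ xs {f g : A → ℕ} → (∀ x → f x ≤ g x) → ∑ xs f ≤ ∑ xs g
  ∑-mono []       f≤g = z≤n
  ∑-mono (x ∷ xs) f≤g = +-mono-≤ (f≤g x) (∑-mono xs f≤g)

  ∑≤*length : ∀ xs {f : A → ℕ} {a} → (∀ {x} → x ∈ xs → f x ≤ a) → ∑ xs f ≤ a * length xs
  ∑≤*length []       {a = a} f≤a = ≤-reflexive (sym (*-zeroʳ a))
  ∑≤*length (x ∷ xs) {f} {a} f≤a = begin
    f x + ∑ xs f        ≤⟨ +-mono-≤ (f≤a (here refl)) (∑≤*length xs (λ x∈xs → f≤a (there x∈xs))) ⟩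
    a + a * length xs ≡⟨ sym (*-suc a (length xs)) ⟩
    a * suc (length xs) ∎
    where open ≤-Reasoning

  ∑<⇒∃≤ : ∀ xs (h : A → ℕ) {a} → ∑ xs h < suc a * length xs → ∃ λ x → x ∈ xs × h x ≤ a
  ∑<⇒∃≤ []       h {a} ∑< = contradiction ∑< (<-irrefl (sym (*-zeroʳ (suc a))))
  ∑<⇒∃≤ (x ∷ xs) h {a} ∑< with h x ≤? a
  ... | yes hx≤a = x , here refl , hx≤a
  ... | no  hx≰a =
    let (y , y∈xs , hy≤a) = ∑<⇒∃≤ xs h ∑xs< in y , there y∈xs , hy≤a
    where
    ∑xs< : ∑ xs h < suc a * length xs
    ∑xs< = +-cancelˡ-< (suc a) _ _ (begin-strict
      suc a + ∑ xs h               ≤⟨ +-monoˡ-≤ (∑ xs h) (≰⇒> hx≰a) ⟩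
      h x + ∑ xs h                 <⟨ ∑< ⟩
      suc a * suc (length xs)      ≡⟨ *-suc (suc a) (length xs) ⟩
      suc a + suc a * length xs    ∎)
      where open ≤-Reasoning

  count : {P : A → Set} → Decidable P → List A → ℕ
  count P? xs = ∑[ x ∈ xs ] 𝟙 (P? x)

  module _ {P : A → Set} (P? : Decidable P) where

    count-∪ : ∀ {Q : A → Set} (Q? : Decidable Q) → ∀ xs → count (P? ∪? Q?) xs ≤ count P? xs + count Q? xs
    count-∪ Q? xs =
      ≤-trans (∑-mono xs 𝟙-∪) (≤-reflexive (∑-+ xs (λ x → 𝟙 (P? x)) (λ x → 𝟙 (Q? x))))
      where
      𝟙-∪ : ∀ x → 𝟙 ((P? ∪? Q?) x) ≤ 𝟙 (P? x) + 𝟙 (Q? x)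
      𝟙-∪ x with P? x | Q? x
      ... | yes _ | _     = s≤s z≤n
      ... | no _  | yes _ = s≤s z≤n
      ... | no _  | no _  = z≤n

    count-filter : ∀ {Q : A → Set} (Q? : Decidable Q) → ∀ xs → count P? (filter Q? xs) ≤ count P? xs
    count-filter Q? []       = z≤n
    count-filter Q? (x ∷ xs) with Q? x
    ... | yes _ = +-monoʳ-≤ (𝟙 (P? x)) (count-filter Q? xs)
    ... | no _  = ≤-trans (count-filter Q? xs) (m≤n+m _ _)

    length-filter : ∀ xs → length (filter P? xs) ≡ count P? xs
    length-filter []       = refl
    length-filter (x ∷ xs) with P? x
    ... | yes _ = cong suc (length-filter xs)
    ... | no _  = length-filter xs

    count+count-∁ : ∀ xs → count P? xs + count (∁? P?) xs ≡ length xs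
    count+count-∁ []       = refl
    count+count-∁ (x ∷ xs) with P? x
    ... | yes _ = cong suc (count+count-∁ xs)
    ... | no _  = trans (+-suc (count P? xs) _) (cong suc (count+count-∁ xs))

    count≡0 : ∀ xs → (∀ {x} → x ∈ xs → ¬ P x) → count P? xs ≡ 0
    count≡0 []       _  = refl
    count≡0 (x ∷ xs) ¬P with P? x
    ... | yes Px = contradiction Px (¬P (here refl))
    ... | no _   = count≡0 xs (λ x∈xs → ¬P (there x∈xs))

    count≤1 : ∀ {xs} → Unique xs → (∀ {x y} → x ∈ xs → y ∈ xs → P x → P y → x ≡ y) →
              count P? xs ≤ 1
    count≤1 []                    _   = z≤n
    count≤1 {x ∷ xs} (x∉xs ∷ uniq) one with P? x
    ... | yes Px = ≤-reflexive (cong suc (count≡0 xs (λ y∈xs Py →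
                     All.lookup x∉xs y∈xs (one (here refl) (there y∈xs) Px Py))))
    ... | no _   = count≤1 uniq (λ x∈ y∈ → one (there x∈) (there y∈))

  lookup-injective : ∀ {xs : List A} → Unique xs → ∀ {i j} → lookup xs i ≡ lookup xs j → i ≡ j
  lookup-injective (_ ∷ _)      {zero}  {zero}  _  = refl
  lookup-injective (x∉xs ∷ _)   {zero}  {suc j} eq = contradiction eq (All.lookup x∉xs (∈-lookup j))
  lookup-injective (x∉xs ∷ _)   {suc i} {zero}  eq = contradiction (sym eq) (All.lookup x∉xs (∈-lookup i))
  lookup-injective (_ ∷ uniq)   {suc i} {suc j} eq = cong suc (lookup-injective uniq eq)

module _ {A : Set} {R : A → A → Set} (R? : ∀ x → Decidable (R x)) where

  -- Take x₀ of in-degree ≤ a (it exists by double counting), discard x₀ and its ≤ 2a neighbours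
  -- in either direction, and recurse.
  independent-family : ∀ r a (xs : List A) →
    (∀ {x} → x ∈ xs → count (R? x) xs ≤ a) → r * suc (2 * a) ≤ length xs →
    Σ (Fin r → A) λ g → (∀ i → g i ∈ xs) × (∀ {i j} → R (g i) (g j) → i ≡ j)
  independent-family zero    a xs _       _   = (λ ()) , (λ ()) , λ { {()} }
  independent-family (suc r) a xs out-deg len = g , g∈xs , g-independent
    where
    open ≤-Reasoning
    K = suc (2 * a)

    in-deg : A → ℕ
    in-deg x = count (λ y → R? y x) xs

    ∑in-deg< : ∑ xs in-deg < suc a * length xs
    ∑in-deg< = begin-strict
      ∑[ x ∈ xs ] ∑[ y ∈ xs ] 𝟙 (R? y x)  ≡⟨ ∑-comm xs xs (λ x y → 𝟙 (R? y x)) ⟩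
      ∑[ y ∈ xs ] count (R? y) xs         ≤⟨ ∑≤*length xs out-deg ⟩
      a * length xs                       <⟨ m<n+m _ (≤-trans (s≤s z≤n) len) ⟩
      suc a * length xs                   ∎

    low-in-deg = ∑<⇒∃≤ xs in-deg ∑in-deg<
    x₀ = proj₁ low-in-deg
    x₀∈xs = proj₁ (proj₂ low-in-deg)

    Near : A → Set
    Near y = R x₀ y ⊎ R y x₀

    Near? : Decidable Near
    Near? = R? x₀ ∪? (λ y → R? y x₀)

    far : List A
    far = filter (∁? Near?) xs

    count-Near≤ : count Near? xs ≤ 2 * a
    count-Near≤ = begin
      count Near? xs                ≤⟨ count-∪ (R? x₀) (λ y → R? y x₀) xs ⟩
      count (R? x₀) xs + in-deg x₀  ≤⟨ +-mono-≤ (out-deg x₀∈xs) (proj₂ (proj₂ low-in-deg)) ⟩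
      a + a                         ≡⟨ cong (a +_) (+-identityʳ a) ⟨
      2 * a                         ∎

    len-far : r * K ≤ length far
    len-far = <⇒≤ (+-cancelˡ-< K _ _ (begin-strict
      suc r * K                             ≤⟨ len ⟩
      length xs                             ≡⟨ count+count-∁ Near? xs ⟨
      count Near? xs + count (∁? Near?) xs  ≡⟨ cong (count Near? xs +_) (length-filter (∁? Near?) xs) ⟨
      count Near? xs + length far           <⟨ +-monoˡ-< (length far) (s≤s count-Near≤) ⟩
      K + length far                        ∎))

    out-deg-far : ∀ {x} → x ∈ far → count (R? x) far ≤ a
    out-deg-far {x} x∈far =
      ≤-trans (count-filter (R? x) (∁? Near?) xs) (out-deg (proj₁ (∈-filter⁻ (∁? Near?) {xs = xs} x∈far)))

    rest = independent-family r a far out-deg-far len-far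

    g : Fin (suc r) → A
    g zero    = x₀
    g (suc i) = proj₁ rest i

    rest-far : ∀ i → proj₁ rest i ∈ xs × ¬ Near (proj₁ rest i)
    rest-far i = ∈-filter⁻ (∁? Near?) {xs = xs} (proj₁ (proj₂ rest) i)

    g∈xs : ∀ i → g i ∈ xs
    g∈xs zero    = x₀∈xs
    g∈xs (suc i) = proj₁ (rest-far i)

    g-independent : ∀ {i j} → R (g i) (g j) → i ≡ j
    g-independent {zero}  {zero}  _ = refl
    g-independent {zero}  {suc j} R₀ⱼ = contradiction (inj₁ R₀ⱼ) (proj₂ (rest-far j))
    g-independent {suc i} {zero}  Rᵢ₀ = contradiction (inj₂ Rᵢ₀) (proj₂ (rest-far i))
    g-independent {suc i} {suc j} Rᵢⱼ = cong suc (proj₂ (proj₂ rest) Rᵢⱼ)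

infix 4 _∈ₑ_ _∈ₑ?_

_∈ₑ_ : ∀ {n} → Fin n → Fin n × Fin n → Set
v ∈ₑ (a , b) = v ≡ a ⊎ v ≡ b

_∈ₑ?_ : ∀ {n} (v : Fin n) p → Dec (v ∈ₑ p)
v ∈ₑ? (a , b) = (v Fin.≟ a) ⊎-dec (v Fin.≟ b)

module _ {n : ℕ} where

  infix 4 _≐_

  ∉ₑ⇒NotOn : ∀ {v : Fin n} {p} → ¬ v ∈ₑ p → NotOn v p
  ∉ₑ⇒NotOn v∉p = v∉p ∘ inj₁ , v∉p ∘ inj₂

  NotOn⇒∉ₑ : ∀ {v : Fin n} {p} → NotOn v p → ¬ v ∈ₑ p
  NotOn⇒∉ₑ (v≢a , _) (inj₁ v≡a) = v≢a v≡a
  NotOn⇒∉ₑ (_ , v≢b) (inj₂ v≡b) = v≢b v≡b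

  Disjoint⇒NotOn : ∀ {p q} {v : Fin n} → DisjointEdges q p → v ∈ₑ p → NotOn v q
  Disjoint⇒NotOn (a∉q , _) (inj₁ refl) = a∉q
  Disjoint⇒NotOn (_ , b∉q) (inj₂ refl) = b∉q

  Meets : Fin n × Fin n → Fin n × Fin n → Set
  Meets q p = proj₁ p ∈ₑ q ⊎ proj₂ p ∈ₑ q

  Meets? : ∀ q p → Dec (Meets q p)
  Meets? q p = (proj₁ p ∈ₑ? q) ⊎-dec (proj₂ p ∈ₑ? q)

  common⇒Meets : ∀ {v : Fin n} {p q} → v ∈ₑ p → v ∈ₑ q → Meets q p
  common⇒Meets (inj₁ refl) v∈q = inj₁ v∈q
  common⇒Meets (inj₂ refl) v∈q = inj₂ v∈q

  _≐_ : Fin n × Fin n → Fin n × Fin n → Set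
  p ≐ q = p ≡ q ⊎ p ≡ swap q

  ∈ₑ-≐ : ∀ {k} {φ : Fin k → Fin n} {p q v} → p ≐ map φ φ q → v ∈ₑ q → φ v ∈ₑ p
  ∈ₑ-≐ (inj₁ refl) (inj₁ refl) = inj₁ refl
  ∈ₑ-≐ (inj₁ refl) (inj₂ refl) = inj₂ refl
  ∈ₑ-≐ (inj₂ refl) (inj₁ refl) = inj₂ refl
  ∈ₑ-≐ (inj₂ refl) (inj₂ refl) = inj₁ refl

  ≐-pair : ∀ {u v : Fin n} {p} → u ≢ v → u ∈ₑ p → v ∈ₑ p → p ≐ (u , v)
  ≐-pair u≢v (inj₁ refl) (inj₁ refl) = contradiction refl u≢v
  ≐-pair u≢v (inj₁ refl) (inj₂ refl) = inj₁ refl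
  ≐-pair u≢v (inj₂ refl) (inj₁ refl) = inj₂ refl
  ≐-pair u≢v (inj₂ refl) (inj₂ refl) = contradiction refl u≢v

  Sorted : Fin n × Fin n → Set
  Sorted (a , b) = a <ᶠ b

  ≐-sorted : ∀ {p q s} → Sorted p → Sorted q → p ≐ s → q ≐ s → p ≡ q
  ≐-sorted _   _   (inj₁ refl) (inj₁ refl) = refl
  ≐-sorted _   _   (inj₂ refl) (inj₂ refl) = refl
  ≐-sorted p<  q<  (inj₁ refl) (inj₂ refl) = contradiction q< (Finₚ.<-asym p<)
  ≐-sorted p<  q<  (inj₂ refl) (inj₁ refl) = contradiction q< (Finₚ.<-asym p<)

  other : ∀ {w : Fin n} {p} → w ∈ₑ p → Fin n
  other {p = _ , b} (inj₁ _) = b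
  other {p = a , _} (inj₂ _) = a

  other-∈ₑ : ∀ {w : Fin n} {p} (w∈p : w ∈ₑ p) → other w∈p ∈ₑ p
  other-∈ₑ (inj₁ _) = inj₂ refl
  other-∈ₑ (inj₂ _) = inj₁ refl

  ≐-other : ∀ {w : Fin n} {p} (w∈p : w ∈ₑ p) → p ≐ (w , other w∈p)
  ≐-other (inj₁ refl) = inj₁ refl
  ≐-other (inj₂ refl) = inj₂ refl

  other-≢ : ∀ {w : Fin n} {p} → Sorted p → (w∈p : w ∈ₑ p) → w ≢ other w∈p
  other-≢ a<b (inj₁ refl) a≡b = Finₚ.<-irrefl a≡b a<b
  other-≢ a<b (inj₂ refl) b≡a = Finₚ.<-irrefl (sym b≡a) a<b

module _ {n : ℕ} (H : Graph n) where

  ends-sorted : ∀ e → Sorted (ends H e)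
  ends-sorted e = All.lookup (E-sorted H) (∈-lookup e)

  edge-determined : ∀ {u v e e′} → u ≢ v → u ∈ₑ ends H e → v ∈ₑ ends H e →
                    u ∈ₑ ends H e′ → v ∈ₑ ends H e′ → e ≡ e′
  edge-determined {e = e} {e′} u≢v u∈e v∈e u∈e′ v∈e′ =
    lookup-injective (E-unique H)
      (≐-sorted (ends-sorted e) (ends-sorted e′) (≐-pair u≢v u∈e v∈e) (≐-pair u≢v u∈e′ v∈e′))

  edges : List (Edge H)
  edges = allFin (edgeCount H)

  deg : Fin n → ℕ
  deg v = count (λ e → v ∈ₑ? ends H e) edges

  edgesAt : Fin n → List (Edge H)
  edgesAt v = filter (λ e → v ∈ₑ? ends H e) edges

  edgesAt-unique : ∀ v → Unique (edgesAt v)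
  edgesAt-unique v = Uniqueₚ.filter⁺ (λ e → v ∈ₑ? ends H e) (Uniqueₚ.allFin⁺ (edgeCount H))

  ∈edgesAt⇒∈ₑ : ∀ {v e} → e ∈ edgesAt v → v ∈ₑ ends H e
  ∈edgesAt⇒∈ₑ {v} = proj₂ ∘ ∈-filter⁻ (λ e → v ∈ₑ? ends H e) {xs = edges}

  count-edgesAt≤1 : ∀ {u v} → u ≢ v → count (λ e → v ∈ₑ? ends H e) (edgesAt u) ≤ 1
  count-edgesAt≤1 {u} u≢v = count≤1 _ (edgesAt-unique u) λ e∈ e′∈ v∈e v∈e′ →
    edge-determined u≢v (∈edgesAt⇒∈ₑ e∈) v∈e (∈edgesAt⇒∈ₑ e′∈) v∈e′

module _ {n : ℕ} {H : Graph n} (f : F₀ H) where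

  private
    fₑ : Edge H → Edge H
    fₑ = proj₁ f

  f-avoids : ∀ {v e} → v ∈ₑ ends H e → NotOn v (ends H (fₑ e))
  f-avoids {e = e} = Disjoint⇒NotOn (proj₂ f e)

  avoids-unless-meets : ∀ {v e e′} → v ∈ₑ ends H e′ →
                        (Meets (ends H e′) (ends H (fₑ e)) → e ≡ e′) → NotOn v (ends H (fₑ e))
  avoids-unless-meets v∈e′ only-e = ∉ₑ⇒NotOn λ v∈fe →
    case only-e (common⇒Meets v∈fe v∈e′) of λ where
      refl → NotOn⇒∉ₑ (f-avoids v∈e′) v∈fe

  exclusive-copy : ∀ {k r} (h : Fin r → Fin k × Fin k) (φ : Fin k → Fin n) → Injective _≡_ _≡_ φ →
                   (ψ : Fin r → Edge H) → (∀ i → ends H (ψ i) ≐ map φ φ (h i)) →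
                   (∀ i v → NotOn (φ v) (ends H (fₑ (ψ i)))) → HasExclusiveCopy H f (List.map h (allFin r))
  exclusive-copy {r = r} h φ φ-inj ψ ψ-ok exclusive = copy , λ j → exclusive (index j)
    where
    P = List.map h (allFin r)

    preimage : ∀ j → ∃ λ i → i ∈ allFin r × lookup P j ≡ h i
    preimage j = ∈-map⁻ h (∈-lookup {xs = P} j)

    index : Fin (length P) → Fin r
    index j = proj₁ (preimage j)

    copy : Copy H P
    copy = record
      { φ = φ ; φ-inj = φ-inj ; ψ = ψ ∘ index
      ; ψ-ok = λ j → subst (λ p → ends H (ψ (index j)) ≐ map φ φ p) (sym (proj₂ (proj₂ (preimage j))))
                           (ψ-ok (index j)) }

  StarConflict : Edge H → Edge H → Set
  StarConflict e e′ = e ≡ e′ ⊎ Meets (ends H e′) (ends H (fₑ e))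

  starConflict? : ∀ e → Decidable (StarConflict e)
  starConflict? e = (e Fin.≟_) ∪? (λ e′ → Meets? (ends H e′) (ends H (fₑ e)))

  -- f(e) misses w, so each of its two endpoints lies on at most one edge at w.
  star-out-degree≤3 : ∀ {w e} → e ∈ edgesAt H w → count (starConflict? e) (edgesAt H w) ≤ 3
  star-out-degree≤3 {w} {e} e∈ = begin
    count (starConflict? e) (edgesAt H w)
      ≤⟨ count-∪ (e Fin.≟_) _ (edgesAt H w) ⟩
    count (e Fin.≟_) (edgesAt H w) + count (λ e′ → Meets? (ends H e′) (ends H (fₑ e))) (edgesAt H w)
      ≤⟨ +-mono-≤ (count≤1 _ (edgesAt-unique H w) (λ _ _ → trans ∘ sym)) (count-∪ _ _ (edgesAt H w)) ⟩
    1 + (count (λ e′ → c ∈ₑ? ends H e′) (edgesAt H w) + count (λ e′ → d ∈ₑ? ends H e′) (edgesAt H w))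
      ≤⟨ +-monoʳ-≤ 1 (+-mono-≤ (count-edgesAt≤1 H w≢c) (count-edgesAt≤1 H w≢d)) ⟩
    3 ∎
    where
    open ≤-Reasoning
    c = proj₁ (ends H (fₑ e))
    d = proj₂ (ends H (fₑ e))
    w≢c = proj₁ (f-avoids (∈edgesAt⇒∈ₑ H e∈))
    w≢d = proj₂ (f-avoids (∈edgesAt⇒∈ₑ H e∈))

  MatchingConflict : Edge H → Edge H → Set
  MatchingConflict e e′ = Meets (ends H e′) (ends H e) ⊎ Meets (ends H e′) (ends H (fₑ e))

  matchingConflict? : ∀ e → Decidable (MatchingConflict e)
  matchingConflict? e = meets? (ends H e) ∪? meets? (ends H (fₑ e))
    where meets? = λ p e′ → Meets? (ends H e′) p

  matching-out-degree≤ : ∀ {D} → (∀ v → deg H v ≤ D) → ∀ e →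
                         count (matchingConflict? e) (edges H) ≤ 4 * D
  matching-out-degree≤ {D} deg≤D e = begin
    count (matchingConflict? e) (edges H)
      ≤⟨ count-∪ (meets? (ends H e)) (meets? (ends H (fₑ e))) (edges H) ⟩
    count (meets? (ends H e)) (edges H) + count (meets? (ends H (fₑ e))) (edges H)
      ≤⟨ +-mono-≤ (count-Meets (ends H e)) (count-Meets (ends H (fₑ e))) ⟩
    (D + D) + (D + D)
      ≡⟨ 2D+2D≡4D D ⟩
    4 * D ∎
    where
    open ≤-Reasoning
    meets? = λ p e′ → Meets? (ends H e′) p

    count-Meets : ∀ p → count (meets? p) (edges H) ≤ D + D
    count-Meets p = ≤-trans (count-∪ _ _ (edges H)) (+-mono-≤ (deg≤D (proj₁ p)) (deg≤D (proj₂ p)))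

    2D+2D≡4D : ∀ D → (D + D) + (D + D) ≡ 4 * D
    2D+2D≡4D = solve-∀

  exclusive-star : ∀ r w → r * 7 ≤ deg H w → HasExclusiveCopy H f (Star r)
  exclusive-star r w 7r≤deg = exclusive-copy (λ i → zero , suc i) ι ι-injective g (≐-other ∘ w∈) exclusive
    where
    family = independent-family starConflict? r 3 (edgesAt H w) star-out-degree≤3
               (subst (r * 7 ≤_) (sym (length-filter _ (edges H))) 7r≤deg)

    g : Fin r → Edge H
    g = proj₁ family

    w∈ : ∀ i → w ∈ₑ ends H (g i)
    w∈ = ∈edgesAt⇒∈ₑ H ∘ proj₁ (proj₂ family)

    conflict⇒≡ : ∀ {i j} → StarConflict (g i) (g j) → i ≡ j
    conflict⇒≡ = proj₂ (proj₂ family)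

    w≢leaf : ∀ i → w ≢ other (w∈ i)
    w≢leaf i = other-≢ (ends-sorted H (g i)) (w∈ i)

    ι : Fin (suc r) → Fin n
    ι zero    = w
    ι (suc i) = other (w∈ i)

    ι-injective : Injective _≡_ _≡_ ι
    ι-injective {zero}  {zero}  _  = refl
    ι-injective {zero}  {suc j} eq = contradiction eq (w≢leaf j)
    ι-injective {suc i} {zero}  eq = contradiction (sym eq) (w≢leaf i)
    ι-injective {suc i} {suc j} eq = cong suc (conflict⇒≡ (inj₁ (edge-determined H (w≢leaf i)
      (w∈ i) (other-∈ₑ (w∈ i)) (w∈ j) (subst (_∈ₑ ends H (g j)) (sym eq) (other-∈ₑ (w∈ j))))))

    exclusive : ∀ i v → NotOn (ι v) (ends H (fₑ (g i)))
    exclusive i zero    = f-avoids (w∈ i)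
    exclusive i (suc j) = avoids-unless-meets (other-∈ₑ (w∈ j)) (cong g ∘ conflict⇒≡ ∘ inj₂)

  exclusive-matching : ∀ r D → (∀ v → deg H v ≤ D) → r * suc (8 * D) ≤ edgeCount H →
                       HasExclusiveCopy H f (Matching r)
  exclusive-matching r D deg≤D r[8D+1]≤m =
    exclusive-copy (λ i → i ↑ˡ r , r ↑ʳ i) ι ι-injective g g-ends exclusive
    where
    family = independent-family matchingConflict? r (4 * D) (edges H)
               (λ _ → matching-out-degree≤ deg≤D _) (begin
      r * suc (2 * (4 * D))  ≡⟨ cong (λ x → r * suc x) (*-assoc 2 4 D) ⟨
      r * suc (8 * D)        ≤⟨ r[8D+1]≤m ⟩
      edgeCount H            ≡⟨ length-tabulate id ⟨
      length (edges H)       ∎)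
      where open ≤-Reasoning

    g : Fin r → Edge H
    g = proj₁ family

    conflict⇒≡ : ∀ {i j} → MatchingConflict (g i) (g j) → i ≡ j
    conflict⇒≡ = proj₂ (proj₂ family)

    shared⇒≡ : ∀ {u i j} → u ∈ₑ ends H (g i) → u ∈ₑ ends H (g j) → i ≡ j
    shared⇒≡ u∈i u∈j = conflict⇒≡ (inj₁ (common⇒Meets u∈i u∈j))

    endpoint : Fin r ⊎ Fin r → Fin n
    endpoint (inj₁ i) = proj₁ (ends H (g i))
    endpoint (inj₂ i) = proj₂ (ends H (g i))

    endpoint-∈ₑ : ∀ s → endpoint s ∈ₑ ends H (g (reduce s))
    endpoint-∈ₑ (inj₁ i) = inj₁ refl
    endpoint-∈ₑ (inj₂ i) = inj₂ refl

    endpoint-injective : Injective _≡_ _≡_ endpoint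
    endpoint-injective {inj₁ i} {inj₁ j} eq = cong inj₁ (shared⇒≡ (inj₁ refl) (inj₁ eq))
    endpoint-injective {inj₂ i} {inj₂ j} eq = cong inj₂ (shared⇒≡ (inj₂ refl) (inj₂ eq))
    endpoint-injective {inj₁ i} {inj₂ j} eq with refl ← shared⇒≡ (inj₁ refl) (inj₂ eq) =
      contradiction (ends-sorted H (g i)) (Finₚ.<-irrefl eq)
    endpoint-injective {inj₂ i} {inj₁ j} eq with refl ← shared⇒≡ (inj₂ refl) (inj₁ eq) =
      contradiction (ends-sorted H (g i)) (Finₚ.<-irrefl (sym eq))

    ι : Fin (r + r) → Fin n
    ι = endpoint ∘ splitAt r

    ι-injective : Injective _≡_ _≡_ ι
    ι-injective {x} {y} eq = begin
      x                        ≡⟨ Finₚ.join-splitAt r r x ⟨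
      Fin.join r r (splitAt r x) ≡⟨ cong (Fin.join r r) (endpoint-injective {splitAt r x} {splitAt r y} eq) ⟩
      Fin.join r r (splitAt r y) ≡⟨ Finₚ.join-splitAt r r y ⟩
      y                        ∎
      where open ≡-Reasoning

    g-ends : ∀ i → ends H (g i) ≐ (ι (i ↑ˡ r) , ι (r ↑ʳ i))
    g-ends i = inj₁ (sym (cong₂ _,_ (cong endpoint (splitAt-↑ˡ r i r)) (cong endpoint (splitAt-↑ʳ r r i))))

    exclusive : ∀ i v → NotOn (ι v) (ends H (fₑ (g i)))
    exclusive i v = avoids-unless-meets (endpoint-∈ₑ (splitAt r v)) (cong g ∘ conflict⇒≡ ∘ inj₂)

  edgeCount≤ : ∀ r → ¬ HasExclusiveCopy H f (Star r) → ¬ HasExclusiveCopy H f (Matching r) →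
               edgeCount H ≤ r * suc (8 * (r * 7))
  edgeCount≤ r no-star no-matching =
    <⇒≤ (≰⇒> (no-matching ∘ exclusive-matching r (r * 7) deg≤7r))
    where
    deg≤7r : ∀ v → deg H v ≤ r * 7
    deg≤7r v = <⇒≤ (≰⇒> (no-star ∘ exclusive-star r v))

admissible⇒edgeCount≤ : ∀ {n} r {H : Graph n} → Admissible (Δ r) H → edgeCount H ≤ r * suc (8 * (r * 7))
admissible⇒edgeCount≤ r (f , none) = edgeCount≤ f r (none ∘ here) (none ∘ there ∘ here)

Covers : ∀ {k} → Pattern k → Set
Covers {k} P = ∀ (v : Fin k) → ∃ λ j → v ∈ₑ lookup P j

covers-map : ∀ {k r} (h : Fin r → Fin k × Fin k) → (∀ v → ∃ λ i → v ∈ₑ h i) →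
             Covers (List.map h (allFin r))
covers-map h on v = Any.index h[i]∈ , subst (v ∈ₑ_) (Anyₚ.lookup-index h[i]∈) (proj₂ (on v))
  where
  h[i]∈ = ∈-map⁺ h (∈-allFin (proj₁ (on v)))

star-covers : ∀ r → Covers (Star (suc r))
star-covers r = covers-map _ λ where
  zero    → zero , inj₁ refl
  (suc i) → i , inj₂ refl

matching-covers : ∀ r → Covers (Matching r)
matching-covers r = covers-map _ on
  where
  on : ∀ v → ∃ λ i → v ∈ₑ (i ↑ˡ r , r ↑ʳ i)
  on v with splitAt r v in eq
  ... | inj₁ i = i , inj₁ (sym (Finₚ.splitAt⁻¹-↑ˡ eq))
  ... | inj₂ i = i , inj₂ (sym (Finₚ.splitAt⁻¹-↑ʳ eq))

copy⇒≤ : ∀ {n k c} (H : Graph n) {P : Pattern k} → Covers P →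
         (∀ e {u} → u ∈ₑ ends H e → toℕ u < c) → Copy H P → k ≤ c
copy⇒≤ H covers bounded C = Finₚ.injective⇒≤ {f = λ v → fromℕ< (image< v)} λ {x} {y} eq →
  φ-inj C (Finₚ.toℕ-injective (begin
    toℕ (φ C x)                ≡⟨ Finₚ.toℕ-fromℕ< (image< x) ⟨
    toℕ (fromℕ< (image< x))    ≡⟨ cong toℕ eq ⟩
    toℕ (fromℕ< (image< y))    ≡⟨ Finₚ.toℕ-fromℕ< (image< y) ⟩
    toℕ (φ C y)                ∎))
  where
  open ≡-Reasoning
  image< : ∀ v → toℕ (φ C v) < _
  image< v = let (j , v∈j) = covers v in bounded (ψ C j) (∈ₑ-≐ {φ = φ C} (ψ-ok C j) v∈j)

module _ {n N : ℕ} (h : Fin N → Fin n × Fin n)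
         (h-injective : Injective _≡_ _≡_ h) (h-sorted : ∀ t → Sorted (h t)) where

  graphOf : Graph n
  graphOf = record
    { E = List.tabulate h ; E-sorted = Allₚ.tabulate⁺ h-sorted ; E-unique = Uniqueₚ.tabulate⁺ h-injective }

  edgeCount-graphOf : edgeCount graphOf ≡ N
  edgeCount-graphOf = length-tabulate h

  ends-graphOf : ∀ e → ∃ λ t → ends graphOf e ≡ h t
  ends-graphOf e = ∈-tabulate⁻ (∈-lookup {xs = List.tabulate h} e)

  F₀-graphOf : (τ : Fin N → Fin N) → (∀ t → DisjointEdges (h (τ t)) (h t)) → F₀ graphOf
  F₀-graphOf τ disjoint = fₑ , fₑ-disjoint
    where
    τt∈ : ∀ t → h (τ t) ∈ List.tabulate h
    τt∈ t = ∈-tabulate⁺ (τ t)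

    fₑ : Edge graphOf → Edge graphOf
    fₑ e = Any.index (τt∈ (proj₁ (ends-graphOf e)))

    fₑ-disjoint : ∀ e → DisjointEdges (ends graphOf (fₑ e)) (ends graphOf e)
    fₑ-disjoint e = subst₂ DisjointEdges (Anyₚ.lookup-index (τt∈ t)) (sym e≡t) (disjoint t)
      where
      t = proj₁ (ends-graphOf e)
      e≡t = proj₂ (ends-graphOf e)

module CompleteBipartite (b : ℕ) {n : ℕ} (2a≤n : suc (suc b) + suc (suc b) ≤ n) where

  a : ℕ
  a = suc (suc b)

  left right : Fin a → Fin n
  left  i = Fin.inject≤ (i ↑ˡ a) 2a≤n
  right j = Fin.inject≤ (a ↑ʳ j) 2a≤n

  toℕ-left : ∀ i → toℕ (left i) ≡ toℕ i
  toℕ-left i = trans (Finₚ.toℕ-inject≤ (i ↑ˡ a) 2a≤n) (Finₚ.toℕ-↑ˡ i a)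

  toℕ-right : ∀ j → toℕ (right j) ≡ a + toℕ j
  toℕ-right j = trans (Finₚ.toℕ-inject≤ (a ↑ʳ j) 2a≤n) (Finₚ.toℕ-↑ʳ a j)

  left<right : ∀ i j → Sorted (left i , right j)
  left<right i j =
    subst₂ _<_ (sym (toℕ-left i)) (sym (toℕ-right j)) (≤-trans (Finₚ.toℕ<n i) (m≤m+n a (toℕ j)))

  left≢right : ∀ i j → left i ≢ right j
  left≢right i j eq = Finₚ.<-irrefl eq (left<right i j)

  left-injective : Injective _≡_ _≡_ left
  left-injective {i} {i′} eq =
    Finₚ.toℕ-injective (trans (sym (toℕ-left i)) (trans (cong toℕ eq) (toℕ-left i′)))

  right-injective : Injective _≡_ _≡_ right
  right-injective {j} {j′} eq =
    Finₚ.toℕ-injective (+-cancelˡ-≡ a _ _ (trans (sym (toℕ-right j)) (trans (cong toℕ eq) (toℕ-right j′))))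

  pair : Fin a × Fin a → Fin n × Fin n
  pair (i , j) = left i , right j

  split : Fin (a * a) → Fin a × Fin a
  split = Fin.remQuot {a} a

  unsplit : Fin a × Fin a → Fin (a * a)
  unsplit = uncurry (Fin.combine {a} {a})

  edge : Fin (a * a) → Fin n × Fin n
  edge = pair ∘ split

  edge-injective : Injective _≡_ _≡_ edge
  edge-injective {t} {t′} eq = begin
    t                  ≡⟨ Finₚ.combine-remQuot {a} a t ⟨
    unsplit (split t)  ≡⟨ cong₂ Fin.combine (left-injective (cong proj₁ eq))
                                            (right-injective (cong proj₂ eq)) ⟩
    unsplit (split t′) ≡⟨ Finₚ.combine-remQuot {a} a t′ ⟩
    t′                 ∎
    where open ≡-Reasoning

  edge-sorted : ∀ t → Sorted (edge t)
  edge-sorted = uncurry left<right ∘ split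

  K : Graph n
  K = graphOf edge edge-injective edge-sorted

  derange : Fin a → Fin a
  derange zero    = suc zero
  derange (suc _) = zero

  derange-≢ : ∀ i → derange i ≢ i
  derange-≢ zero    ()
  derange-≢ (suc _) ()

  F₀-K : F₀ K
  F₀-K = F₀-graphOf edge edge-injective edge-sorted τ disjoint
    where
    τ : Fin (a * a) → Fin (a * a)
    τ = unsplit ∘ map derange derange ∘ split

    pair-disjoint : ∀ ij → DisjointEdges (pair (map derange derange ij)) (pair ij)
    pair-disjoint (i , j) =
      (derange-≢ i ∘ sym ∘ left-injective , left≢right i (derange j)) ,
      (left≢right (derange i) j ∘ sym , derange-≢ j ∘ sym ∘ right-injective)

    disjoint : ∀ t → DisjointEdges (edge (τ t)) (edge t)
    disjoint t = subst (λ p → DisjointEdges p (edge t))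
                   (sym (cong pair (Finₚ.remQuot-combine {a} {a} _ _))) (pair-disjoint (split t))

  pair-bounded : ∀ ij {u} → u ∈ₑ pair ij → toℕ u < a + a
  pair-bounded (i , j) (inj₁ refl) = subst (_< a + a) (sym (toℕ-left i)) (≤-trans (Finₚ.toℕ<n i) (m≤m+n a a))
  pair-bounded (i , j) (inj₂ refl) = subst (_< a + a) (sym (toℕ-right j)) (+-monoʳ-< a (Finₚ.toℕ<n j))

  K-bounded : ∀ e {u} → u ∈ₑ ends K e → toℕ u < a + a
  K-bounded e u∈ = pair-bounded (split t) (subst (_ ∈ₑ_) e≡t u∈)
    where
    t = proj₁ (ends-graphOf edge edge-injective edge-sorted e)
    e≡t = proj₂ (ends-graphOf edge edge-injective edge-sorted e)

  -- K has no copy of either pattern at all: both have more than a + a vertices, none isolated.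
  K-admissible : ∀ r → a + a ≤ r → Admissible (Δ r) K
  K-admissible (suc r) 2a≤r = F₀-K , λ where
    (here (C , _))         → <-irrefl refl (≤-trans (copy⇒≤ K (star-covers r) K-bounded C) 2a≤r)
    (there (here (C , _))) → <-irrefl refl (≤-trans (m<m+n (suc r) z<s)
                               (≤-trans (copy⇒≤ K (matching-covers (suc r)) K-bounded C) 2a≤r))

greatest : ∀ {P : ℕ → Set} → Decidable P → ∀ B → (∀ {s} → P s → s ≤ B) → ∃ P →
           ∃ λ s → P s × ∀ {t} → P t → t ≤ s
greatest P? B bounded ∃P with P? B
... | yes PB = B , PB , bounded
greatest {P} P? zero    bounded (s , Ps) | no ¬P0 = contradiction (subst P (n≤0⇒n≡0 (bounded Ps)) Ps) ¬P0
greatest {P} P? (suc B) bounded ∃P       | no ¬PB =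
  greatest P? B (λ Pt → m<1+n⇒m≤n (≤∧≢⇒< (bounded Pt) λ t≡1+B → ¬PB (subst P t≡1+B Pt))) ∃P

Searchable : Set → Set₁
Searchable A = ∀ {P : A → Set} → Decidable P → Dec (∃ P)

search-× : ∀ {A B} → Searchable A → Searchable B → Searchable (A × B)
search-× search-A search-B P? =
  map′ (λ (a , b , p) → (a , b) , p) (λ ((a , b) , p) → a , b , p) (search-A λ a → search-B λ b → P? (a , b))

search-Vector : ∀ {A} → Searchable A → ∀ k {P : Vector A k → Set} → (∀ {g h} → g ≗ h → P g → P h) →
                Decidable P → Dec (∃ P)
search-Vector search-A zero    resp P? = map′ (Vector.[] ,_) (λ (g , p) → resp (λ ()) p) (P? Vector.[])
search-Vector search-A (suc k) resp P? = map′
  (λ (a , g , p) → a Vector.∷ g , p)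
  (λ (g , p) → Vector.head g , Vector.tail g , resp (λ { zero → refl ; (suc i) → refl }) p)
  (search-A λ a → search-Vector search-A k (λ g≗h → resp λ { zero → refl ; (suc i) → g≗h i })
                                             (λ g → P? (a Vector.∷ g)))

NotOn? : ∀ {n} (v : Fin n) p → Dec (NotOn v p)
NotOn? v (a , b) = ¬? (v Fin.≟ a) ×-dec ¬? (v Fin.≟ b)

_≐?_ : ∀ {n} (p q : Fin n × Fin n) → Dec (p ≐ q)
p ≐? q = ≡-dec Fin._≟_ Fin._≟_ p q ⊎-dec ≡-dec Fin._≟_ Fin._≟_ p (swap q)

module _ {n : ℕ} (H : Graph n) where

  hasExclusiveCopy? : (f : F₀ H) → ∀ {k} (P : Pattern k) → Dec (HasExclusiveCopy H f P)
  hasExclusiveCopy? f {k} P = map′ to-copy from-copy (search-Vector Finₚ.any? k resp ExclusiveCopyVia?)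
    where
    Realises : (Fin k → Fin n) → Fin (length P) → Edge H → Set
    Realises φ j e = ends H e ≐ map φ φ (lookup P j) × ∀ v → NotOn (φ v) (ends H (proj₁ f e))

    ExclusiveCopyVia : (Fin k → Fin n) → Set
    ExclusiveCopyVia φ = (∀ x y → φ x ≡ φ y → x ≡ y) × ∀ j → ∃ (Realises φ j)

    ExclusiveCopyVia? : Decidable ExclusiveCopyVia
    ExclusiveCopyVia? φ =
      Finₚ.all? (λ x → Finₚ.all? λ y → (φ x Fin.≟ φ y) →-dec (x Fin.≟ y)) ×-dec
      Finₚ.all? (λ j → Finₚ.any? λ e → (ends H e ≐? map φ φ (lookup P j)) ×-dec
                                          Finₚ.all? (λ v → NotOn? (φ v) (ends H (proj₁ f e))))

    resp : ∀ {φ φ′} → φ ≗ φ′ → ExclusiveCopyVia φ → ExclusiveCopyVia φ′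
    resp φ≗φ′ (injective , realised) =
      (λ x y eq → injective x y (trans (φ≗φ′ x) (trans eq (sym (φ≗φ′ y))))) ,
      λ j → let (e , e≐ , avoids) = realised j in
        e , subst (ends H e ≐_) (cong₂ _,_ (φ≗φ′ _) (φ≗φ′ _)) e≐ ,
        λ v → subst (λ w → NotOn w (ends H (proj₁ f e))) (φ≗φ′ v) (avoids v)

    to-copy : ∃ ExclusiveCopyVia → HasExclusiveCopy H f P
    to-copy (φ , injective , realised) =
      record { φ = φ ; φ-inj = injective _ _ ; ψ = proj₁ ∘ realised ; ψ-ok = proj₁ ∘ proj₂ ∘ realised } ,
      proj₂ ∘ proj₂ ∘ realised

    from-copy : HasExclusiveCopy H f P → ∃ ExclusiveCopyVia
    from-copy (C , exclusive) = φ C , (λ _ _ → φ-inj C) , λ j → ψ C j , ψ-ok C j , exclusive j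

  admissible? : ∀ 𝒢 → Dec (Admissible 𝒢 H)
  admissible? 𝒢 = map′ (λ (fₑ , d , none) → (fₑ , d) , none) (λ ((fₑ , d) , none) → fₑ , d , none)
                       (search-Vector Finₚ.any? (edgeCount H) resp Good?)
    where
    Disjoint : (Edge H → Edge H) → Set
    Disjoint fₑ = ∀ e → DisjointEdges (ends H (fₑ e)) (ends H e)

    Good : (Edge H → Edge H) → Set
    Good fₑ = Σ (Disjoint fₑ) λ d → ¬ Any (λ G → HasExclusiveCopy H (fₑ , d) (proj₂ G)) 𝒢

    Good? : Decidable Good
    Good? fₑ with Finₚ.all? (λ e → NotOn? (proj₁ (ends H e)) (ends H (fₑ e)) ×-dec
                                   NotOn? (proj₂ (ends H e)) (ends H (fₑ e)))
    ... | no ¬d = no (¬d ∘ proj₁)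
    ... | yes d = map′ (d ,_) proj₂ (¬? (Any.any? (λ G → hasExclusiveCopy? (fₑ , d) (proj₂ G)) 𝒢))

    resp : ∀ {fₑ fₑ′} → fₑ ≗ fₑ′ → Good fₑ → Good fₑ′
    resp {fₑ} {fₑ′} fₑ≗fₑ′ (d , none) = d′ , none ∘ Any.map back
      where
      d′ : Disjoint fₑ′
      d′ e = subst (λ x → DisjointEdges (ends H x) (ends H e)) (fₑ≗fₑ′ e) (d e)

      back : ∀ {k} {P : Pattern k} → HasExclusiveCopy H (fₑ′ , d′) P → HasExclusiveCopy H (fₑ , d) P
      back (C , exclusive) = C , λ j v →
        subst (λ x → NotOn (φ C v) (ends H x)) (sym (fₑ≗fₑ′ (ψ C j))) (exclusive j v)

module _ {n : ℕ} (𝒢 : Family) where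

  graph : (l : List (Fin n × Fin n)) → All Sorted l → Unique l → Graph n
  graph l sorted unique = record { E = l ; E-sorted = sorted ; E-unique = unique }

  AdmissibleEdges : List (Fin n × Fin n) → Set
  AdmissibleEdges l =
    Σ (All Sorted l) λ sorted → Σ (Unique l) λ unique → Admissible 𝒢 (graph l sorted unique)

  admissible-irrelevant : ∀ {l s s′ u u′} → Admissible 𝒢 (graph l s u) → Admissible 𝒢 (graph l s′ u′)
  admissible-irrelevant (f , none) = f , none ∘ Any.map λ (C , exclusive) →
    record { φ = φ C ; φ-inj = φ-inj C ; ψ = ψ C ; ψ-ok = ψ-ok C } , exclusive

  admissibleEdges? : Decidable AdmissibleEdges
  admissibleEdges? l
    with All.all? (λ p → proj₁ p Fin.<? proj₂ p) l | UniqueDec.unique? (≡-dec Fin._≟_ Fin._≟_) l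
  ... | no ¬sorted | _         = no (¬sorted ∘ proj₁)
  ... | yes _      | no ¬unique = no (¬unique ∘ proj₁ ∘ proj₂)
  ... | yes sorted | yes unique = map′ (λ adm → sorted , unique , adm) (admissible-irrelevant ∘ proj₂ ∘ proj₂)
                                       (admissible? (graph l sorted unique) 𝒢)

  enumerate : ∀ {s} (l : List (Fin n × Fin n)) → length l ≡ s →
              ∃ λ (g : Fin s → Fin n × Fin n) → List.tabulate g ≡ l
  enumerate l refl = lookup l , tabulate-lookup l

  admissible-with-edgeCount? : Decidable (λ s → Σ (Graph n) λ H → Admissible 𝒢 H × edgeCount H ≡ s)
  admissible-with-edgeCount? s = map′ to-graph from-graph
    (search-Vector (search-× Finₚ.any? Finₚ.any?) s (subst AdmissibleEdges ∘ tabulate-cong)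
                   (admissibleEdges? ∘ List.tabulate))
    where
    to-graph : ∃ (AdmissibleEdges ∘ List.tabulate) → Σ (Graph n) λ H → Admissible 𝒢 H × edgeCount H ≡ s
    to-graph (g , sorted , unique , adm) = graph (List.tabulate g) sorted unique , adm , length-tabulate g

    from-graph : (Σ (Graph n) λ H → Admissible 𝒢 H × edgeCount H ≡ s) → ∃ (AdmissibleEdges ∘ List.tabulate)
    from-graph (H , adm , edgeCount≡s) with g , g-enumerates ← enumerate (E H) edgeCount≡s =
      g , subst AdmissibleEdges (sym g-enumerates) (E-sorted H , E-unique H , adm)

  s-exists : ∀ B → (∀ (H : Graph n) → Admissible 𝒢 H → edgeCount H ≤ B) →
             (H₀ : Graph n) → Admissible 𝒢 H₀ → ∃ (IsS n 𝒢)
  s-exists B bounded H₀ adm₀ =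
    let (s , achieved , maximal) = greatest admissible-with-edgeCount? B
          (λ (H , adm , edgeCount≡s) → subst (_≤ B) edgeCount≡s (bounded H adm))
          (edgeCount H₀ , H₀ , adm₀ , refl)
    in s , achieved , λ H adm → maximal (H , adm , refl)

  IsS⇒≤ : ∀ {s B} → IsS n 𝒢 s → (∀ (H : Graph n) → Admissible 𝒢 H → edgeCount H ≤ B) → s ≤ B
  IsS⇒≤ ((H , adm , refl) , _) bounded = bounded H adm

⌊n/2⌋+⌊n/2⌋≤n : ∀ n → ⌊ n /2⌋ + ⌊ n /2⌋ ≤ n
⌊n/2⌋+⌊n/2⌋≤n n = ≤-trans (+-monoʳ-≤ ⌊ n /2⌋ (⌊n/2⌋≤⌈n/2⌉ n)) (≤-reflexive (⌊n/2⌋+⌈n/2⌉≡n n))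

n≤1+⌊n/2⌋+⌊n/2⌋ : ∀ n → n ≤ suc (⌊ n /2⌋ + ⌊ n /2⌋)
n≤1+⌊n/2⌋+⌊n/2⌋ zero          = z≤n
n≤1+⌊n/2⌋+⌊n/2⌋ (suc zero)    = ≤-refl
n≤1+⌊n/2⌋+⌊n/2⌋ (suc (suc n)) =
  s≤s (≤-trans (s≤s (n≤1+⌊n/2⌋+⌊n/2⌋ n)) (≤-reflexive (cong suc (sym (+-suc ⌊ n /2⌋ ⌊ n /2⌋)))))

r*r≤9*⌊r/2⌋² : ∀ r → 2 ≤ r → r * r ≤ 9 * (⌊ r /2⌋ * ⌊ r /2⌋)
r*r≤9*⌊r/2⌋² r 2≤r = begin
  r * r                  ≤⟨ *-mono-≤ r≤3a r≤3a ⟩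
  (3 * a) * (3 * a)      ≡⟨ square-3* a ⟩
  9 * (a * a)            ∎
  where
  open ≤-Reasoning
  a = ⌊ r /2⌋

  square-3* : ∀ a → (3 * a) * (3 * a) ≡ 9 * (a * a)
  square-3* = solve-∀

  r≤3a : r ≤ 3 * a
  r≤3a = begin
    r                    ≤⟨ n≤1+⌊n/2⌋+⌊n/2⌋ r ⟩
    1 + (a + a)          ≤⟨ +-monoˡ-≤ (a + a) (⌊n/2⌋-mono 2≤r) ⟩
    a + (a + a)          ≡⟨ cong (λ x → a + (a + x)) (+-identityʳ a) ⟨
    3 * a                ∎

r[1+56r]≤57r² : ∀ r → r * suc (8 * (r * 7)) ≤ 57 * (r * r)
r[1+56r]≤57r² zero        = z≤n
r[1+56r]≤57r² r@(suc _)   = begin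
  r * suc (8 * (r * 7))  ≡⟨ expand r ⟩
  r + 56 * (r * r)       ≤⟨ +-monoˡ-≤ (56 * (r * r)) (m≤m*n r r) ⟩
  r * r + 56 * (r * r)   ≡⟨⟩
  57 * (r * r)           ∎
  where
  open ≤-Reasoning

  expand : ∀ r → r * suc (8 * (r * 7)) ≡ r + 56 * (r * r)
  expand = solve-∀

bipartite-witness : ∀ r {n} → 4 ≤ r → r ≤ n →
                    Σ (Graph n) λ K → Admissible (Δ r) K × edgeCount K ≡ ⌊ r /2⌋ * ⌊ r /2⌋
bipartite-witness r@(suc (suc (suc (suc r′)))) (s≤s (s≤s (s≤s (s≤s _)))) r≤n =
  K , K-admissible r (⌊n/2⌋+⌊n/2⌋≤n r) , edgeCount-graphOf edge edge-injective edge-sorted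
  where open CompleteBipartite ⌊ r′ /2⌋ (≤-trans (⌊n/2⌋+⌊n/2⌋≤n r) r≤n)

proposition4p6 : Σ ℕ λ c₁ → Σ ℕ λ c₂ → Σ ℕ λ r₀ → Σ (ℕ → ℕ) λ N →
    ∀ r → r₀ ≤ r → ∀ n → N r ≤ n →
      Σ ℕ λ s → IsS n (Δ r) s × (r * r ≤ c₁ * s) × (s ≤ c₂ * (r * r))
proposition4p6 = 9 , 57 , 4 , id , λ r 4≤r n r≤n →
  let (K , K-admissible , |K|) = bipartite-witness r 4≤r r≤n
      upper = λ (H : Graph n) → admissible⇒edgeCount≤ r {H}
      (s , isS) = s-exists (Δ r) _ upper K K-admissible
  in s , isS ,
     (begin
       r * r                     ≤⟨ r*r≤9*⌊r/2⌋² r (≤-trans (s≤s (s≤s z≤n)) 4≤r) ⟩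
       9 * (⌊ r /2⌋ * ⌊ r /2⌋)   ≡⟨ cong (9 *_) |K| ⟨
       9 * edgeCount K           ≤⟨ *-monoʳ-≤ 9 (proj₂ isS K K-admissible) ⟩
       9 * s                     ∎) ,
     ≤-trans (IsS⇒≤ (Δ r) isS upper) (r[1+56r]≤57r² r)
  where open ≤-Reasoning
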